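{- If $\mathcal{H}$ is a hypergraph in which every edge has size at least $3$ and which has no isolated vertex, then $\gamma_{P_I}(\mathcal{H})\le\gamma_P(\mathcal{H})\le\frac{|V(\mathcal{H})|}{3}$.
   Context: A hypergraph $\mathcal{H}=(V,E)$ has finite vertex set $V$ and edges nonempty subsets of $V$; throughout, hypergraphs are reduced (no edge is contained in another distinct edge) and have at least one edge. A vertex is isolated if it lies in no edge. $N[a]=\bigcup_{a\in e\in E}e$, $N(a)=N[a]\setminus\{a\}$. Power domination: given $S_0\subseteq V$, first all vertices of $\bigcup_{v\in S_0}N[v]$ become observed; then repeatedly, if all unobserved neighbors of an observed vertex $v$ lie in one edge incident to $v$, they become observed. $\gamma_P(\mathcal{H})$ is the minimum size of an $S_0$ making all vertices observed. Infectious power domination: given $S_0$, set $S=\bigcup_{v\in S_0}N[v]$; then while some nonempty $A\subseteq S$ and edge $e$ satisfy $A\subseteq e$ and [every vertex $v\notin S$ such that $A\cup\{v\}$ is contained in some edge lies in $e$], add the vertices of $e$ to $S$. $\gamma_{P_I}(\mathcal{H})$ is the minimum size of an $S_0$ with $S=V$ at termination. -}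

module Defs where

open import Data.Nat using (ℕ; _≤_; _*_)
open import Data.Fin using (Fin)
open import Data.Fin.Subset using (Subset; _∈_; _∉_; _⊆_; ∣_∣; Nonempty; ⊤)
open import Data.List using (List; [])
open import Data.List.Membership.Propositional using () renaming (_∈_ to _∈ₗ_)
open import Data.List.Relation.Unary.All using (All)
open import Data.Product using (Σ; ∃; ∃-syntax; _×_; _,_)
open import Data.Sum using (_⊎_)
open import Relation.Binary.PropositionalEquality using (_≡_; _≢_)
open import Relation.Binary.Construct.Closure.ReflexiveTransitive using (Star)
open import Function.Bundles using (_⇔_)

-- A (reduced) hypergraph on vertex set Fin n; edges are subsets of Fin n.
-- Subsets are Vec Bool n, so propositional equality is set equality.
record Hypergraph (n : ℕ) : Set where
  field
    edges         : List (Subset n)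
    edgesNonempty : All Nonempty edges
    hasEdge       : edges ≢ []
    reduced       : ∀ e e′ → e ∈ₗ edges → e′ ∈ₗ edges → e ⊆ e′ → e ≡ e′
open Hypergraph public

module _ {n : ℕ} (H : Hypergraph n) where

  IsEdge : Subset n → Set
  IsEdge e = e ∈ₗ edges H

  InClosedNbhd : Fin n → Fin n → Set
  InClosedNbhd u a = ∃[ e ] (IsEdge e × a ∈ e × u ∈ e)

  InOpenNbhd : Fin n → Fin n → Set
  InOpenNbhd u a = InClosedNbhd u a × u ≢ a

  NoIsolated : Set
  NoIsolated = ∀ v → ∃[ e ] (IsEdge e × v ∈ e)

  EdgesAtLeast3 : Set
  EdgesAtLeast3 = All (λ e → 3 ≤ ∣ e ∣) (edges H)

  IsInitial : Subset n → Subset n → Set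
  IsInitial S₀ S = ∀ u → u ∈ S ⇔ (∃[ v ] (v ∈ S₀ × InClosedNbhd u v))

  PStep : Subset n → Subset n → Set
  PStep S S′ = ∃[ v ] ∃[ e ]
      ( v ∈ S × IsEdge e × v ∈ e
      × (∀ u → InOpenNbhd u v → u ∉ S → u ∈ e)
      × (∀ u → u ∈ S′ ⇔ (u ∈ S ⊎ InOpenNbhd u v)))

  IStep : Subset n → Subset n → Set
  IStep S S′ = ∃[ A ] ∃[ e ]
      ( Nonempty A × A ⊆ S × IsEdge e × A ⊆ e
      × (∀ v → v ∉ S → (∃[ e′ ] (IsEdge e′ × A ⊆ e′ × v ∈ e′)) → v ∈ e)
      × (∀ u → u ∈ S′ ⇔ (u ∈ S ⊎ u ∈ e)))

  -- S₀ is a power dominating set: the process can reach V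
  -- (the terminal set of the process is independent of the order of steps)
  IsPDS : Subset n → Set
  IsPDS S₀ = ∃[ S ] (IsInitial S₀ S × Star PStep S ⊤)

  IsIPDS : Subset n → Set
  IsIPDS S₀ = ∃[ S ] (IsInitial S₀ S × Star IStep S ⊤)

  IsγP : ℕ → Set
  IsγP k = (∃[ S₀ ] (IsPDS S₀ × ∣ S₀ ∣ ≡ k)) × (∀ S₀ → IsPDS S₀ → k ≤ ∣ S₀ ∣)

  IsγPI : ℕ → Set
  IsγPI k = (∃[ S₀ ] (IsIPDS S₀ × ∣ S₀ ∣ ≡ k)) × (∀ S₀ → IsIPDS S₀ → k ≤ ∣ S₀ ∣)

module Submission where

-- The bound γ_P ≤ n / 3 comes from ordinary domination.  Every list R of sets
-- of size at least three has a "small dominator": a set D with 3 ∣D∣ ≤ ∣⋃ R∣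
-- such that each vertex covered by R shares a member of R with a vertex of D
-- (smallDominator, by induction on R: a new member e either adds no vertex, is
-- disjoint from the rest, or meets it in a pivot q which becomes a dominator
-- only when it pays for three new vertices).  Applied to the edges of H, such a
-- D observes every vertex in the domination phase, so it is power dominating.
--
-- For γ_{P_I} ≤ γ_P, both propagation rules are treated as monotone,
-- inflationary step relations on subsets (module Process): every run can be
-- saturated to a closed set, and a power-domination step is mimicked by the
-- infectious step with A a single vertex, so the infectious process started
-- from a power dominating set also reaches V.  All notions are decidable over
-- the finite universe, so sets of least size exist (leastSize); the theorem
-- combines these facts.

open import Defs
open import Data.Nat using (ℕ; suc; _≤_; _<_; _*_; _+_; z≤n; s≤s)
open import Data.Nat.Properties
  using ( ≤-refl; ≤-trans; <⇒≤; ≮⇒≥; _<?_; *-monoʳ-≤; +-monoʳ-≤; +-monoˡ-≤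
        ; +-suc; +-identityʳ; m≤m+n; *-distribˡ-+; module ≤-Reasoning)
open import Data.Nat.Induction using (<-wellFounded)
open import Data.Bool using (true; false; _≟_)
open import Data.Fin using (Fin) renaming (_≟_ to _≟ᶠ_)
open import Data.Fin.Properties using (any?; all?)
open import Data.Fin.Subset
open import Data.Fin.Subset.Properties
open import Data.Fin.Subset.Induction using (Acc; acc; ⊃-wellFounded)
open import Data.Vec using ([]; _∷_; tabulate)
open import Data.Vec.Properties using (lookup∘tabulate; lookup⇒[]=; []=⇒lookup; ≡-dec)
open import Data.List using (List; []; _∷_; length; filter)
import Data.List.Membership.DecPropositional as DecMembership
open import Data.List.Membership.Propositional using (lose) renaming (_∈_ to _∈ₗ_)
open import Data.List.Membership.Propositional.Properties using (∈-filter⁺; ∈-filter⁻)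
open import Data.List.Relation.Unary.Any using (here; there)
open import Data.List.Relation.Unary.All using (All; _∷_)
open import Data.List.Relation.Unary.All.Properties using (filter⁺)
open import Data.List.Relation.Binary.Subset.Propositional using () renaming (_⊆_ to _⊆ₗ_)
open import Data.List.Properties using (length-filter; filter-notAll)
open import Data.Product using (∃-syntax; _×_; _,_; proj₁; proj₂)
open import Data.Sum using (_⊎_; inj₁; inj₂; [_,_]; map₂)
open import Data.Empty using (⊥-elim)
open import Function using (_∘_; id; _on_)
open import Function.Bundles using (_⇔_; mk⇔; Equivalence)
open import Level using (0ℓ)
open import Relation.Binary using (Rel)
open import Relation.Binary.Construct.Closure.ReflexiveTransitive using (Star; ε; _◅_; fold)
import Relation.Binary.Construct.On as On
open import Relation.Unary using (Decidable)
open import Relation.Nullary using (Dec; yes; no; ¬?; does; contradiction)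
open import Relation.Nullary.Decidable using (_×-dec_; _⊎-dec_; _→-dec_; map′; dec-true)
open import Relation.Binary.PropositionalEquality
  using (_≡_; refl; _≢_; sym; trans; cong; subst; module ≡-Reasoning)

∣p∪q∣+∣p∩q∣ : ∀ {m} (p q : Subset m) → ∣ p ∪ q ∣ + ∣ p ∩ q ∣ ≡ ∣ p ∣ + ∣ q ∣
∣p∪q∣+∣p∩q∣ []          []          = refl
∣p∪q∣+∣p∩q∣ (true ∷ p)  (true ∷ q)  = cong suc (begin
  ∣ p ∪ q ∣ + suc ∣ p ∩ q ∣   ≡⟨ +-suc _ _ ⟩
  suc (∣ p ∪ q ∣ + ∣ p ∩ q ∣) ≡⟨ cong suc (∣p∪q∣+∣p∩q∣ p q) ⟩
  suc (∣ p ∣ + ∣ q ∣)         ≡⟨ sym (+-suc _ _) ⟩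
  ∣ p ∣ + suc ∣ q ∣           ∎)
  where open ≡-Reasoning
∣p∪q∣+∣p∩q∣ (true ∷ p)  (false ∷ q) = cong suc (∣p∪q∣+∣p∩q∣ p q)
∣p∪q∣+∣p∩q∣ (false ∷ p) (true ∷ q)  = trans (cong suc (∣p∪q∣+∣p∩q∣ p q)) (sym (+-suc _ _))
∣p∪q∣+∣p∩q∣ (false ∷ p) (false ∷ q) = ∣p∪q∣+∣p∩q∣ p q

_⇔?_ : {A B : Set} → Dec A → Dec B → Dec (A ⇔ B)
a? ⇔? b? = map′ (λ (f , g) → mk⇔ f g) (λ A⇔B → Equivalence.to A⇔B , Equivalence.from A⇔B)
                ((a? →-dec b?) ×-dec (b? →-dec a?))

module _ {n : ℕ} where

  ⟦_⟧ : {P : Fin n → Set} → Decidable P → Subset n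
  ⟦ P? ⟧ = tabulate (does ∘ P?)

  ∈⟦⟧⁺ : {P : Fin n → Set} (P? : Decidable P) {x : Fin n} → P x → x ∈ ⟦ P? ⟧
  ∈⟦⟧⁺ P? {x} px =
    lookup⇒[]= x _ (trans (lookup∘tabulate (does ∘ P?) x) (dec-true (P? x) px))

  ∈⟦⟧⁻ : {P : Fin n → Set} (P? : Decidable P) {x : Fin n} → x ∈ ⟦ P? ⟧ → P x
  ∈⟦⟧⁻ P? {x} x∈ with P? x | trans (sym (lookup∘tabulate (does ∘ P?) x)) ([]=⇒lookup x∈)
  ... | yes px | _ = px
  ... | no _   | ()

  ⊆-or-witness : (A B : Subset n) → A ⊆ B ⊎ ∃[ x ] (x ∈ A × x ∉ B)
  ⊆-or-witness A B with any? (λ x → x ∈? A ×-dec ¬? (x ∈? B))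
  ... | yes witness = inj₂ witness
  ... | no none = inj₁ included
    where
    included : A ⊆ B
    included {x} x∈A with x ∈? B
    ... | yes x∈B = x∈B
    ... | no x∉B  = contradiction (x , x∈A , x∉B) none

  ⁅⁆⊆ : {x : Fin n} {B : Subset n} → x ∈ B → ⁅ x ⁆ ⊆ B
  ⁅⁆⊆ {x} x∈B y∈⁅x⁆ = subst (_∈ _) (sym (x∈⁅y⁆⇒x≡y x y∈⁅x⁆)) x∈B

  ∣p∪q∣≤∣p∣+∣q∣ : (p q : Subset n) → ∣ p ∪ q ∣ ≤ ∣ p ∣ + ∣ q ∣
  ∣p∪q∣≤∣p∣+∣q∣ p q = subst (∣ p ∪ q ∣ ≤_) (∣p∪q∣+∣p∩q∣ p q) (m≤m+n _ _)

  ∣p∪q∣-disjoint : (p q : Subset n) → Empty (p ∩ q) → ∣ p ∣ + ∣ q ∣ ≡ ∣ p ∪ q ∣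
  ∣p∪q∣-disjoint p q disjoint = begin
    ∣ p ∣ + ∣ q ∣         ≡⟨ sym (∣p∪q∣+∣p∩q∣ p q) ⟩
    ∣ p ∪ q ∣ + ∣ p ∩ q ∣ ≡⟨ cong (λ r → ∣ p ∪ q ∣ + ∣ r ∣) (Empty-unique disjoint) ⟩
    ∣ p ∪ q ∣ + ∣ ⊥ {n} ∣ ≡⟨ cong (∣ p ∪ q ∣ +_) (∣⊥∣≡0 n) ⟩
    ∣ p ∪ q ∣ + 0         ≡⟨ +-identityʳ _ ⟩
    ∣ p ∪ q ∣             ∎
    where open ≡-Reasoning

  three-outside : {A B : Subset n} {a b c : Fin n} → A ⊆ B →
    a ∈ B → b ∈ B → c ∈ B → a ∉ A → b ∉ A → c ∉ A → b ≢ a → c ≢ a → c ≢ b →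
    3 + ∣ A ∣ ≤ ∣ B ∣
  three-outside {A} {B} {a} {b} {c} A⊆B a∈B b∈B c∈B a∉A b∉A c∉A b≢a c≢a c≢b = begin
    3 + ∣ A ∣             ≤⟨ +-monoʳ-≤ 3 (p⊆q⇒∣p∣≤∣q∣ A⊆B-abc) ⟩
    3 + ∣ B - a - b - c ∣ ≤⟨ s≤s (s≤s (x∈p⇒∣p-x∣<∣p∣ c∈B-ab)) ⟩
    2 + ∣ B - a - b ∣     ≤⟨ s≤s (x∈p⇒∣p-x∣<∣p∣ b∈B-a) ⟩
    1 + ∣ B - a ∣         ≤⟨ x∈p⇒∣p-x∣<∣p∣ a∈B ⟩
    ∣ B ∣                 ∎
    where
    open ≤-Reasoning
    b∈B-a : b ∈ B - a
    b∈B-a = x∈p∧x≢y⇒x∈p-y b∈B b≢a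
    c∈B-ab : c ∈ B - a - b
    c∈B-ab = x∈p∧x≢y⇒x∈p-y (x∈p∧x≢y⇒x∈p-y c∈B c≢a) c≢b
    A⊆B-abc : A ⊆ B - a - b - c
    A⊆B-abc y∈A = x∈p∧x≢y⇒x∈p-y (x∈p∧x≢y⇒x∈p-y (x∈p∧x≢y⇒x∈p-y (A⊆B y∈A)
      (λ { refl → a∉A y∈A })) (λ { refl → b∉A y∈A })) (λ { refl → c∉A y∈A })

  ∈⋃⁺ : {x : Fin n} {g : Subset n} (R : List (Subset n)) → g ∈ₗ R → x ∈ g → x ∈ ⋃ R
  ∈⋃⁺ (g ∷ R) (here refl) x∈g = x∈p∪q⁺ (inj₁ x∈g)
  ∈⋃⁺ (h ∷ R) (there g∈R) x∈g = x∈p∪q⁺ (inj₂ (∈⋃⁺ R g∈R x∈g))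

  ∈⋃⁻ : {x : Fin n} (R : List (Subset n)) → x ∈ ⋃ R → ∃[ g ] (g ∈ₗ R × x ∈ g)
  ∈⋃⁻ []      x∈ = ⊥-elim (∉⊥ x∈)
  ∈⋃⁻ (h ∷ R) x∈ with x∈p∪q⁻ h (⋃ R) x∈
  ... | inj₁ x∈h = h , here refl , x∈h
  ... | inj₂ x∈R = let g , g∈R , x∈g = ∈⋃⁻ R x∈R in g , there g∈R , x∈g

  ⋃-mono : {R R′ : List (Subset n)} → R ⊆ₗ R′ → ⋃ R ⊆ ⋃ R′
  ⋃-mono {R} {R′} R⊆R′ x∈ = let g , g∈R , x∈g = ∈⋃⁻ R x∈ in ∈⋃⁺ R′ (R⊆R′ g∈R) x∈g

module _ {n : ℕ} where

  Dominates : List (Subset n) → Subset n → Set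
  Dominates R D = ∀ {x} → x ∈ ⋃ R → ∃[ g ] (g ∈ₗ R × x ∈ g × ∃[ d ] (d ∈ g × d ∈ D))

  SmallDominator : List (Subset n) → Set
  SmallDominator R = ∃[ D ] (Dominates R D × 3 * ∣ D ∣ ≤ ∣ ⋃ R ∣)

  Large : Subset n → Set
  Large e = 3 ≤ ∣ e ∣

  transfer : {R R′ : List (Subset n)} → R ⊆ₗ R′ → ⋃ R′ ⊆ ⋃ R →
    SmallDominator R → SmallDominator R′
  transfer {R′ = R′} R⊆R′ R′⊆R (D , dominates , small) =
    D , dominates′ , ≤-trans small (p⊆q⇒∣p∣≤∣q∣ (⋃-mono R⊆R′))
    where
    dominates′ : Dominates R′ D
    dominates′ x∈ = let g , g∈R , near-D = dominates (R′⊆R x∈) in g , R⊆R′ g∈R , near-D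

  extend : {R R′ : List (Subset n)} (d : Fin n) → R′ ⊆ₗ R →
    (∀ {x} → x ∈ ⋃ R → x ∉ ⋃ R′ → ∃[ g ] (g ∈ₗ R × x ∈ g × d ∈ g)) →
    3 + ∣ ⋃ R′ ∣ ≤ ∣ ⋃ R ∣ → SmallDominator R′ → SmallDominator R
  extend {R} {R′} d R′⊆R reaches growth (D , dominates , small) =
    ⁅ d ⁆ ∪ D , dominates′ , small′
    where
    dominates′ : Dominates R (⁅ d ⁆ ∪ D)
    dominates′ {x} x∈ with x ∈? ⋃ R′
    ... | yes x∈R′ = let g , g∈R′ , x∈g , d′ , d′∈g , d′∈D = dominates x∈R′
                     in g , R′⊆R g∈R′ , x∈g , d′ , d′∈g , x∈p∪q⁺ (inj₂ d′∈D)
    ... | no x∉R′  = let g , g∈R , x∈g , d∈g = reaches x∈ x∉R′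
                     in g , g∈R , x∈g , d , d∈g , x∈p∪q⁺ (inj₁ (x∈⁅x⁆ d))
    small′ : 3 * ∣ ⁅ d ⁆ ∪ D ∣ ≤ ∣ ⋃ R ∣
    small′ = begin
      3 * ∣ ⁅ d ⁆ ∪ D ∣       ≤⟨ *-monoʳ-≤ 3 (∣p∪q∣≤∣p∣+∣q∣ ⁅ d ⁆ D) ⟩
      3 * (∣ ⁅ d ⁆ ∣ + ∣ D ∣) ≡⟨ cong (λ k → 3 * (k + ∣ D ∣)) (∣⁅x⁆∣≡1 d) ⟩
      3 * (1 + ∣ D ∣)         ≡⟨ *-distribˡ-+ 3 1 ∣ D ∣ ⟩
      3 + 3 * ∣ D ∣           ≤⟨ +-monoʳ-≤ 3 small ⟩
      3 + ∣ ⋃ R′ ∣            ≤⟨ growth ⟩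
      ∣ ⋃ R ∣                 ∎
      where open ≤-Reasoning

  avoids? : (q : Fin n) → Decidable (q ∉_)
  avoids? q g = ¬? (q ∈? g)

  without : Fin n → List (Subset n) → List (Subset n)
  without q = filter (avoids? q)

  without-⊆ : (q : Fin n) (R : List (Subset n)) → without q R ⊆ₗ R
  without-⊆ q R g∈ = proj₁ (∈-filter⁻ (avoids? q) {xs = R} g∈)

  q∉⋃without : (q : Fin n) (R : List (Subset n)) → q ∉ ⋃ (without q R)
  q∉⋃without q R q∈ = let g , g∈ , q∈g = ∈⋃⁻ (without q R) q∈
                      in proj₂ (∈-filter⁻ (avoids? q) {xs = R} g∈) q∈g

  ∈⋃without : {q x : Fin n} {g : Subset n} (R : List (Subset n)) →
    g ∈ₗ R → x ∈ g → q ∉ g → x ∈ ⋃ (without q R)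
  ∈⋃without {q} R g∈R x∈g q∉g = ∈⋃⁺ (without q R) (∈-filter⁺ (avoids? q) g∈R q∉g) x∈g

  without-shorter : {q : Fin n} (R : List (Subset n)) → q ∈ ⋃ R →
    length (without q R) < length R
  without-shorter {q} R q∈ = let g , g∈R , q∈g = ∈⋃⁻ R q∈
    in filter-notAll (avoids? q) R (lose g∈R (λ q∉g → q∉g q∈g))

  covered-member : {e : Subset n} {R : List (Subset n)} → e ⊆ ⋃ R →
    SmallDominator R → SmallDominator (e ∷ R)
  covered-member {e} {R} e⊆R = transfer there (λ x∈ → [ e⊆R , id ] (x∈p∪q⁻ e (⋃ R) x∈))

  -- e is disjoint from the rest: any vertex p of e dominates it, and e brings
  -- at least three new vertices.
  disjoint-member : {e : Subset n} {R : List (Subset n)} {p : Fin n} →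
    Large e → p ∈ e → Empty (e ∩ ⋃ R) → SmallDominator R → SmallDominator (e ∷ R)
  disjoint-member {e} {R} {p} large p∈e disjoint =
    extend p there reaches (subst (3 + ∣ ⋃ R ∣ ≤_) (∣p∪q∣-disjoint e (⋃ R) disjoint)
                                  (+-monoˡ-≤ ∣ ⋃ R ∣ large))
    where
    reaches : ∀ {x} → x ∈ e ∪ ⋃ R → x ∉ ⋃ R → ∃[ g ] (g ∈ₗ e ∷ R × x ∈ g × p ∈ g)
    reaches x∈ x∉R =
      e , here refl , [ id , (λ x∈R → contradiction x∈R x∉R) ] (x∈p∪q⁻ e (⋃ R) x∈) , p∈e

  -- e meets R in the pivot q; compare with the family e ∷ without q R.
  module Pivot {e : Subset n} {R : List (Subset n)} {q : Fin n} (q∈e : q ∈ e) where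

    -- The members through q lie inside e and the members avoiding q: drop them.
    redundant : ⋃ R ⊆ ⋃ (e ∷ without q R) →
      SmallDominator (e ∷ without q R) → SmallDominator (e ∷ R)
    redundant R⊆ = transfer kept⊆ (λ x∈ → [ x∈p∪q⁺ ∘ inj₁ , R⊆ ] (x∈p∪q⁻ e (⋃ R) x∈))
      where
      kept⊆ : e ∷ without q R ⊆ₗ e ∷ R
      kept⊆ (here refl) = here refl
      kept⊆ (there g∈)  = there (without-⊆ q R g∈)

    -- Some vertex x of R lies beyond e and the members avoiding q: then q
    -- dominates everything those members leave uncovered, which includes the
    -- three vertices q, x and a vertex p private to e.
    essential : {p x : Fin n} → q ∈ ⋃ R → p ∈ e → p ∉ ⋃ R →
      x ∈ ⋃ R → x ∉ ⋃ (e ∷ without q R) →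
      SmallDominator (without q R) → SmallDominator (e ∷ R)
    essential q∈R p∈e p∉R x∈R x∉ = extend q (there ∘ without-⊆ q R) reaches
      (three-outside (⋃-mono (there ∘ without-⊆ q R))
        (x∈p∪q⁺ (inj₁ q∈e)) (x∈p∪q⁺ (inj₁ p∈e)) (x∈p∪q⁺ (inj₂ x∈R))
        (q∉⋃without q R) (p∉R ∘ ⋃-mono (without-⊆ q R)) (x∉ ∘ x∈p∪q⁺ ∘ inj₂)
        (λ { refl → p∉R q∈R }) (λ { refl → x∉ (x∈p∪q⁺ (inj₁ q∈e)) })
        (λ { refl → x∉ (x∈p∪q⁺ (inj₁ p∈e)) }))
      where
      reaches : ∀ {y} → y ∈ e ∪ ⋃ R → y ∉ ⋃ (without q R) →
        ∃[ g ] (g ∈ₗ e ∷ R × y ∈ g × q ∈ g)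
      reaches {y} y∈ y∉ with x∈p∪q⁻ e (⋃ R) y∈
      ... | inj₁ y∈e = e , here refl , y∈e , q∈e
      ... | inj₂ y∈R with ∈⋃⁻ R y∈R
      ...   | g , g∈R , y∈g with q ∈? g
      ...     | yes q∈g = g , there g∈R , y∈g , q∈g
      ...     | no q∉g  = contradiction (∈⋃without R g∈R y∈g q∉g) y∉

  smallDominator : (k : ℕ) (R : List (Subset n)) → length R ≤ k → All Large R →
    SmallDominator R
  smallDominator _ [] _ _ =
    ⊥ , (λ x∈ → ⊥-elim (∉⊥ x∈)) , subst (λ c → 3 * c ≤ c) (sym (∣⊥∣≡0 n)) z≤n
  smallDominator (suc k) (e ∷ R) (s≤s len) (large-e ∷ large-R) with ⊆-or-witness e (⋃ R)
  ... | inj₁ e⊆R = covered-member e⊆R (smallDominator k R len large-R)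
  ... | inj₂ (p , p∈e , p∉R) with nonempty? (e ∩ ⋃ R)
  ...   | no disjoint =
          disjoint-member large-e p∈e disjoint (smallDominator k R len large-R)
  ...   | yes (q , q∈e∩R) with x∈p∩q⁻ e (⋃ R) q∈e∩R
  ...     | q∈e , q∈R with ⊆-or-witness (⋃ R) (⋃ (e ∷ without q R))
  ...       | inj₁ R⊆ = Pivot.redundant q∈e R⊆
              (smallDominator k (e ∷ without q R) (≤-trans (without-shorter R q∈R) len)
                              (large-e ∷ filter⁺ (avoids? q) large-R))
  ...       | inj₂ (x , x∈R , x∉) = Pivot.essential q∈e q∈R p∈e p∉R x∈R x∉
              (smallDominator k (without q R) (≤-trans (length-filter (avoids? q) R) len)
                              (filter⁺ (avoids? q) large-R))

LeastSize : {n : ℕ} → (Subset n → Set) → ℕ → Set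
LeastSize Q k = (∃[ M ] (Q M × ∣ M ∣ ≡ k)) × (∀ S → Q S → k ≤ ∣ S ∣)

leastSize : {n : ℕ} {Q : Subset n → Set} → Decidable Q → {S : Subset n} → Q S →
  ∃[ k ] (LeastSize Q k × k ≤ ∣ S ∣)
leastSize {Q = Q} Q? {S} = descend S (On.wellFounded ∣_∣ <-wellFounded S)
  where
  descend : ∀ S → Acc (_<_ on ∣_∣) S → Q S → ∃[ k ] (LeastSize Q k × k ≤ ∣ S ∣)
  descend S (acc smaller) qS with anySubset? (λ S′ → Q? S′ ×-dec ∣ S′ ∣ <? ∣ S ∣)
  ... | yes (S′ , qS′ , S′<S) =
        let k , least , k≤S′ = descend S′ (smaller S′<S) qS′
        in  k , least , ≤-trans k≤S′ (<⇒≤ S′<S)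
  ... | no none =
        ∣ S ∣ , ((S , qS , refl) , λ S′ qS′ → ≮⇒≥ (λ S′<S → none (S′ , qS′ , S′<S))) , ≤-refl

module Process {n : ℕ} (Step : Rel (Subset n) 0ℓ) where

  Closed : Subset n → Set
  Closed C = ∀ {C′} → Step C C′ → C′ ⊆ C

  Covers : Rel (Subset n) 0ℓ → Set
  Covers Step₂ = ∀ {T T′ C} → Step₂ T T′ → T ⊆ C → ∃[ C′ ] (Step C C′ × T′ ⊆ C′)

  confined : {Step₂ : Rel (Subset n) 0ℓ} → Covers Step₂ →
    ∀ {T T′ C} → Star Step₂ T T′ → T ⊆ C → Closed C → T′ ⊆ C
  confined cover ε        T⊆C closed = T⊆C
  confined cover (s ◅ ss) T⊆C closed =
    let C′ , step , T₁⊆C′ = cover s T⊆C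
    in  confined cover ss (λ x∈ → closed step (T₁⊆C′ x∈)) closed

  module Saturation (Step? : ∀ S S′ → Dec (Step S S′))
                    (inflationary : ∀ {S S′} → Step S S′ → S ⊆ S′) where

    grows : ∀ {S S′} → Star Step S S′ → S ⊆ S′
    grows = fold _⊆_ (λ s S₁⊆S′ x∈ → S₁⊆S′ (inflationary s x∈)) (λ x∈ → x∈)

    progress : ∀ S → (∃[ S′ ] (Step S S′ × S ⊂ S′)) ⊎ Closed S
    progress S with anySubset? (λ S′ → Step? S S′ ×-dec any? (λ x → x ∈? S′ ×-dec ¬? (x ∈? S)))
    ... | yes (S′ , step , new) = inj₁ (S′ , step , inflationary step , new)
    ... | no stuck = inj₂ closed
      where
      closed : Closed S
      closed {S′} step {x} x∈S′ with x ∈? S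
      ... | yes x∈S = x∈S
      ... | no x∉S = contradiction (S′ , step , x , x∈S′ , x∉S) stuck

    saturate : ∀ S → ∃[ C ] (Star Step S C × Closed C)
    saturate S = go S (⊃-wellFounded S)
      where
      go : ∀ S → Acc _⊃_ S → ∃[ C ] (Star Step S C × Closed C)
      go S (acc larger) with progress S
      ... | inj₂ closed = S , ε , closed
      ... | inj₁ (S′ , step , S⊂S′) =
            let C , run , closed = go S′ (larger S⊂S′) in C , step ◅ run , closed

    -- If Step covers Step₂ and a Step₂-run from S reaches V, so does a Step-run:
    -- the saturation of S contains the end of every covered run.
    completes : {Step₂ : Rel (Subset n) 0ℓ} → Covers Step₂ →
      ∀ {S} → Star Step₂ S ⊤ → Star Step S ⊤
    completes cover {S} run₂ with saturate S
    ... | C , run , closed with ⊆-antisym ⊆⊤ (confined cover run₂ (grows run) closed)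
    ...   | refl = run

    -- For a monotone process, reaching V means that the saturation is V.
    reaches⊤? : Covers Step → ∀ S → Dec (Star Step S ⊤)
    reaches⊤? cover S with saturate S
    ... | C , run , closed with ⊤ ⊆? C
    ...   | yes ⊤⊆C = yes (subst (Star Step S) (⊆-antisym ⊆⊤ ⊤⊆C) run)
    ...   | no ⊤⊈C  = no (λ run⊤ → ⊤⊈C (confined cover run⊤ (grows run) closed))

module _ {n : ℕ} (H : Hypergraph n) where

  isEdge? : Decidable (IsEdge H)
  isEdge? e = DecMembership._∈?_ (≡-dec _≟_) e (edges H)

  closedNbhd? : ∀ u a → Dec (InClosedNbhd H u a)
  closedNbhd? u a = anySubset? (λ e → isEdge? e ×-dec a ∈? e ×-dec u ∈? e)

  openNbhd? : ∀ u a → Dec (InOpenNbhd H u a)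
  openNbhd? u a = closedNbhd? u a ×-dec ¬? (u ≟ᶠ a)

  pStep? : ∀ S S′ → Dec (PStep H S S′)
  pStep? S S′ = any? λ v → anySubset? λ e →
    v ∈? S ×-dec isEdge? e ×-dec v ∈? e
    ×-dec all? (λ u → openNbhd? u v →-dec ¬? (u ∈? S) →-dec u ∈? e)
    ×-dec all? (λ u → (u ∈? S′) ⇔? ((u ∈? S) ⊎-dec openNbhd? u v))

  iStep? : ∀ S S′ → Dec (IStep H S S′)
  iStep? S S′ = anySubset? λ A → anySubset? λ e →
    nonempty? A ×-dec A ⊆? S ×-dec isEdge? e ×-dec A ⊆? e
    ×-dec all? (λ v → ¬? (v ∈? S) →-dec
                 anySubset? (λ e′ → isEdge? e′ ×-dec A ⊆? e′ ×-dec v ∈? e′) →-dec v ∈? e)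
    ×-dec all? (λ u → (u ∈? S′) ⇔? ((u ∈? S) ⊎-dec u ∈? e))

  initial? : ∀ S₀ S → Dec (IsInitial H S₀ S)
  initial? S₀ S = all? λ u → (u ∈? S) ⇔? any? (λ v → v ∈? S₀ ×-dec closedNbhd? u v)

  N⟨_⟩ : Fin n → Subset n
  N⟨ v ⟩ = ⟦ (λ u → openNbhd? u v) ⟧

  pStep : ∀ {S v e} → v ∈ S → IsEdge H e → v ∈ e →
    (∀ u → InOpenNbhd H u v → u ∉ S → u ∈ e) → PStep H S (S ∪ N⟨ v ⟩)
  pStep {S} {v} {e} v∈S edge v∈e unobserved⊆e = v , e , v∈S , edge , v∈e , unobserved⊆e ,
    λ u → mk⇔ (map₂ (∈⟦⟧⁻ (λ w → openNbhd? w v)) ∘ x∈p∪q⁻ S N⟨ v ⟩)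
              (x∈p∪q⁺ ∘ map₂ (∈⟦⟧⁺ (λ w → openNbhd? w v)))

  iStep : ∀ {S A e} → Nonempty A → A ⊆ S → IsEdge H e → A ⊆ e →
    (∀ v → v ∉ S → ∃[ e′ ] (IsEdge H e′ × A ⊆ e′ × v ∈ e′) → v ∈ e) →
    IStep H S (S ∪ e)
  iStep {S} {A} {e} nonempty A⊆S edge A⊆e unobserved⊆e =
    A , e , nonempty , A⊆S , edge , A⊆e , unobserved⊆e , λ u → mk⇔ (x∈p∪q⁻ S e) x∈p∪q⁺

  pInflationary : ∀ {S S′} → PStep H S S′ → S ⊆ S′
  pInflationary (_ , _ , _ , _ , _ , _ , S′≡) x∈S = Equivalence.from (S′≡ _) (inj₁ x∈S)

  iInflationary : ∀ {S S′} → IStep H S S′ → S ⊆ S′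
  iInflationary (_ , _ , _ , _ , _ , _ , _ , S′≡) x∈S = Equivalence.from (S′≡ _) (inj₁ x∈S)

  pCovers : Process.Covers (PStep H) (PStep H)
  pCovers {C = C} (v , e , v∈T , edge , v∈e , unobserved⊆e , T′≡) T⊆C =
    C ∪ N⟨ v ⟩ ,
    pStep (T⊆C v∈T) edge v∈e (λ u u~v u∉C → unobserved⊆e u u~v (u∉C ∘ T⊆C)) ,
    λ u∈T′ → [ x∈p∪q⁺ ∘ inj₁ ∘ T⊆C , x∈p∪q⁺ ∘ inj₂ ∘ ∈⟦⟧⁺ (λ w → openNbhd? w v) ]
               (Equivalence.to (T′≡ _) u∈T′)

  iCovers : Process.Covers (IStep H) (IStep H)
  iCovers {C = C} (A , e , nonempty , A⊆T , edge , A⊆e , unobserved⊆e , T′≡) T⊆C =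
    C ∪ e ,
    iStep nonempty (T⊆C ∘ A⊆T) edge A⊆e (λ v v∉C → unobserved⊆e v (v∉C ∘ T⊆C)) ,
    λ u∈T′ → [ x∈p∪q⁺ ∘ inj₁ ∘ T⊆C , x∈p∪q⁺ ∘ inj₂ ] (Equivalence.to (T′≡ _) u∈T′)

  -- A power-domination step at v through e is the infectious step with A = {v}:
  -- every unobserved vertex sharing an edge with v is a neighbour of v, so lies in e.
  iCoversP : Process.Covers (IStep H) (PStep H)
  iCoversP {C = C} (v , e , v∈T , edge , v∈e , unobserved⊆e , T′≡) T⊆C =
    C ∪ e , iStep (v , x∈⁅x⁆ v) (⁅⁆⊆ (T⊆C v∈T)) edge (⁅⁆⊆ v∈e) unobserved⊆e′ , T′⊆C∪e
    where
    unobserved⊆e′ : ∀ w → w ∉ C → ∃[ e′ ] (IsEdge H e′ × ⁅ v ⁆ ⊆ e′ × w ∈ e′) → w ∈ e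
    unobserved⊆e′ w w∉C (e′ , edge′ , v⊆e′ , w∈e′) =
      unobserved⊆e w ((e′ , edge′ , v⊆e′ (x∈⁅x⁆ v) , w∈e′) , λ { refl → w∉C (T⊆C v∈T) })
                   (w∉C ∘ T⊆C)
    T′⊆C∪e : _ ⊆ C ∪ e
    T′⊆C∪e {u} u∈T′ with Equivalence.to (T′≡ u) u∈T′ | u ∈? C
    ... | inj₁ u∈T | _       = x∈p∪q⁺ (inj₁ (T⊆C u∈T))
    ... | inj₂ _   | yes u∈C = x∈p∪q⁺ (inj₁ u∈C)
    ... | inj₂ u~v | no u∉C  = x∈p∪q⁺ (inj₂ (unobserved⊆e u u~v (u∉C ∘ T⊆C)))

  private
    module P = Process.Saturation (PStep H) pStep? pInflationary
    module I = Process.Saturation (IStep H) iStep? iInflationary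

  isPDS? : Decidable (IsPDS H)
  isPDS? S₀ = anySubset? (λ S → initial? S₀ S ×-dec P.reaches⊤? pCovers S)

  isIPDS? : Decidable (IsIPDS H)
  isIPDS? S₀ = anySubset? (λ S → initial? S₀ S ×-dec I.reaches⊤? iCovers S)

  pds⇒ipds : ∀ {S₀} → IsPDS H S₀ → IsIPDS H S₀
  pds⇒ipds (S , initial , run) = S , initial , I.completes iCoversP run

  dominating⇒pds : NoIsolated H → ∀ {D} → Dominates (edges H) D → IsPDS H D
  dominating⇒pds noIsolated {D} dominates =
    ⊤ , (λ u → mk⇔ (λ _ → dominated u) (λ _ → ∈⊤)) , ε
    where
    dominated : ∀ u → ∃[ d ] (d ∈ D × InClosedNbhd H u d)
    dominated u =
      let e , edge , u∈e = noIsolated u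
          g , g∈E , u∈g , d , d∈g , d∈D = dominates (∈⋃⁺ (edges H) edge u∈e)
      in d , d∈D , g , g∈E , d∈g , u∈g

corollary4p6 : (n : ℕ) (H : Hypergraph n) → EdgesAtLeast3 H → NoIsolated H →
    ∃[ kI ] ∃[ kP ] (IsγPI H kI × IsγP H kP × kI ≤ kP × 3 * kP ≤ n)
-- A small dominator D of the edges is power dominating, so γ_P ≤ ∣ D ∣ ≤ n / 3;
-- a least power dominating set is infectious power dominating, so γ_{P_I} ≤ γ_P.
corollary4p6 n H large noIsolated =
  let D , dominates , small = smallDominator (length (edges H)) (edges H) ≤-refl large
      kP , γP , kP≤∣D∣ = leastSize (isPDS? H) (dominating⇒pds H noIsolated dominates)
      (MP , MP-pds , ∣MP∣≡kP) , _ = γP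
      kI , γI , _ = leastSize (isIPDS? H) (pds⇒ipds H MP-pds)
      _ , kI-least = γI
  in kI , kP , γI , γP , subst (kI ≤_) ∣MP∣≡kP (kI-least MP (pds⇒ipds H MP-pds)) , (begin
       3 * kP            ≤⟨ *-monoʳ-≤ 3 kP≤∣D∣ ⟩
       3 * ∣ D ∣         ≤⟨ small ⟩
       ∣ ⋃ (edges H) ∣   ≤⟨ ∣p∣≤n (⋃ (edges H)) ⟩
       n                 ∎)
  where open ≤-Reasoning
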